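{- Let $M$ be a prime power. Then every multilinear polynomial $f(x_1,\dots,x_n)$ with integer coefficients which represents $\mathsf{NAND}_n\bmod M$ over $\{0,1\}^n$ satisfies $\mathrm{cov}(f)\le M-1$.
   Context: A polynomial $f(x_1,\dots,x_n)$ with integer coefficients represents $\mathsf{NAND}_n\bmod M$ over $\{0,1\}^n$ if $f(\mathbf 1)\equiv0\pmod M$ and $f(x)\not\equiv0\pmod M$ for all $x\in\{0,1\}^n\setminus\{\mathbf 1\}$, where $\mathbf 1$ is the all-ones vector. For a multilinear polynomial $f$, $\mathrm{cov}(f)$ is the minimum number of monomials of $f$ (with nonzero coefficient) whose variable sets together contain every variable appearing in $f$. -}

module Defs where

open import Data.Nat as ℕ using (ℕ; zero; suc)
open import Data.Bool using (Bool; true; false; if_then_else_)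
open import Data.Integer using (ℤ; +_; _+_; _*_)
open import Data.Integer.Divisibility using (_∣_)
open import Data.Fin using (Fin)
open import Data.Fin.Subset using (Subset; _∈_; ⊤)
import Data.Nat.Primality
open import Data.Vec using (Vec; []; _∷_; lookup)
open import Data.List using (List; []; _∷_; map; _++_; length)
open import Data.List.Relation.Unary.All using (All)
open import Data.List.Relation.Unary.Any using (Any)
open import Data.Product using (Σ; _×_; ∃)
open import Relation.Nullary using (¬_)
open import Relation.Binary.PropositionalEquality using (_≡_)

-- A multilinear polynomial in x₁,…,xₙ with integer coefficients is given by
-- its coefficient function: the monomial ∏_{i ∈ S} x_i has coefficient f S.
MultilinearPoly : ℕ → Set
MultilinearPoly n = Subset n → ℤ

allSubsets : (n : ℕ) → List (Subset n)
allSubsets zero    = [] ∷ []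
allSubsets (suc n) = map (true ∷_) (allSubsets n) ++ map (false ∷_) (allSubsets n)

⟦_⟧ : Bool → ℤ
⟦ true ⟧  = + 1
⟦ false ⟧ = + 0

monoEval : ∀ {n} → Subset n → Vec Bool n → ℤ
monoEval []          []       = + 1
monoEval (true ∷ S)  (b ∷ x)  = ⟦ b ⟧ * monoEval S x
monoEval (false ∷ S) (_ ∷ x)  = monoEval S x

sumℤ : List ℤ → ℤ
sumℤ []       = + 0
sumℤ (a ∷ as) = a + sumℤ as

eval : ∀ {n} → MultilinearPoly n → Vec Bool n → ℤ
eval {n} f x = sumℤ (map (λ S → f S * monoEval S x) (allSubsets n))

_≡0mod_ : ℤ → ℕ → Set
a ≡0mod M = (+ M) ∣ a

RepresentsNAND : ∀ {n} → ℕ → MultilinearPoly n → Set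
RepresentsNAND {n} M f =
  (eval f (Data.Vec.replicate n true) ≡0mod M)
  × (∀ (x : Vec Bool n) → ¬ (x ≡ Data.Vec.replicate n true) → ¬ (eval f x ≡0mod M))

Appears : ∀ {n} → MultilinearPoly n → Fin n → Set
Appears f i = ∃ λ S → ¬ (f S ≡ + 0) × i ∈ S

IsCover : ∀ {n} → MultilinearPoly n → List (Subset n) → Set
IsCover f Ts = All (λ T → ¬ (f T ≡ + 0)) Ts
             × (∀ i → Appears f i → Any (λ T → i ∈ T) Ts)

CovLe : ∀ {n} → MultilinearPoly n → ℕ → Set
CovLe f k = ∃ λ Ts → IsCover f Ts × length Ts ℕ.≤ k

IsPrimePower : ℕ → Set
IsPrimePower M = ∃ λ p → ∃ λ k → Data.Nat.Primality.Prime p × 1 ℕ.≤ k × M ≡ p ℕ.^ k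

-- Write M = p ^ k = m + 1 and replace f by the list L of monomials made of m copies of the
-- constant monomial and (f_S mod M) copies of each x_S.  At x ∈ {0,1}ⁿ, if c monomials of L
-- equal 1, then c + 1 ≡ f(x) (mod M), so M ∣ c + 1 exactly when x = 𝟏.  For a prime power M,
-- C(c, M − 1) ≡ [M ∣ c + 1] (mod p); hence the elementary symmetric polynomial e_m(L), whose
-- value at x is C(c, m), agrees with x₁⋯xₙ modulo p on the whole cube.  Its top coefficient is
-- then ≡ 1 (mod p), in particular nonzero; as e_m(L) is a sum of products of m members of L,
-- some m of them involve every variable.  The constant copies involve none, so the others are
-- at most m = M − 1 monomials of f covering all its variables.

module Submission where

open import Defs
open import Data.Nat as ℕ using (ℕ; zero; suc; _<_; _^_; _∸_)
import Data.Nat.Properties as ℕ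
import Data.Nat.Tactic.RingSolver as ℕ-Solver
open import Data.Nat.Combinatorics using (_C_; nCk+nC[k+1]≡[n+1]C[k+1]; nC1≡n; nCn≡1; k>n⇒nCk≡0)
open import Data.Nat.Divisibility as ℕ∣ using (divides; _∣?_)
open import Data.Nat.DivMod using (_%_; _/_; m≡m%n+[m/n]*n; m%n<n)
open import Data.Nat.Primality using (Prime; euclidsLemma; prime⇒nonZero; ¬prime[1])
open import Data.Integer using (ℤ; +_; -_; _+_; _-_; _*_; _%ℕ_; _/ℕ_)
import Data.Integer.Properties as ℤ
import Data.Integer.Tactic.RingSolver as ℤ-Solver
open import Data.Integer.DivMod using (a≡a%ℕn+[a/ℕn]*n)
open import Data.Integer.Divisibility.Signed as ℤ∣
  using (_∣_; ∣ᵤ⇒∣; ∣⇒∣ᵤ; ∣-refl; ∣m∣n⇒∣m+n; ∣m∣n⇒∣m-n; ∣m⇒∣-m; ∣m⇒∣m*n; ∣m+n∣m⇒∣n)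
open import Data.Bool using (Bool; true; false)
import Data.Bool as Bool
open import Data.Vec using (Vec; []; _∷_; replicate)
import Data.Vec.Base as Vec
open import Data.Vec.Properties using (≡-dec)
open import Data.Fin using () renaming (zero to fzero; suc to fsuc)
open import Data.Fin.Subset using (Subset; _∈_; ⊤; ⊥; _∪_)
open import Data.Fin.Subset.Properties using (x∈p∪q⁻; ∉⊥)
open import Data.List as List using (List; []; _∷_; _++_; length; filter)
open import Data.List.Properties using (map-++; map-replicate; length-filter)
open import Data.List.Relation.Unary.All as All using (All; []; _∷_)
open import Data.List.Relation.Unary.All.Properties using (all-filter)
open import Data.List.Relation.Unary.Any using (Any; here; there)
open import Data.List.Membership.Propositional using (find; lose) renaming (_∈_ to _∈ₗ_)
open import Data.List.Membership.Propositional.Properties using (∈-++⁻; ∈-concatMap⁻; ∈-filter⁺)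
open import Data.Product using (∃; _×_; _,_; proj₁; proj₂)
open import Data.Sum using (_⊎_; inj₁; inj₂)
open import Function using (_∘_)
open import Relation.Nullary using (¬_; Dec; yes; no; ¬?; contradiction)
open import Relation.Binary.PropositionalEquality
import Relation.Binary.Reasoning.Base.Single

infix 4 _≡_mod_
data _≡_mod_ (a b : ℤ) (d : ℕ) : Set where
  ≡-mod : + d ∣ a - b → a ≡ b mod d

module _ {d : ℕ} where

  ≡-mod-refl : ∀ {a} → a ≡ a mod d
  ≡-mod-refl {a} = ≡-mod (subst (+ d ∣_) (sym (ℤ.+-inverseʳ a)) (∣ᵤ⇒∣ (d ℕ∣.∣0)))

  ≡-mod-trans : ∀ {a b c} → a ≡ b mod d → b ≡ c mod d → a ≡ c mod d
  ≡-mod-trans {a} {b} {c} (≡-mod d∣a-b) (≡-mod d∣b-c) =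
    ≡-mod (subst (+ d ∣_) (telescope a b c) (∣m∣n⇒∣m+n d∣a-b d∣b-c))
    where
    telescope : ∀ a b c → (a - b) + (b - c) ≡ a - c
    telescope = ℤ-Solver.solve-∀

  ≡-mod-sym : ∀ {a b} → a ≡ b mod d → b ≡ a mod d
  ≡-mod-sym {a} {b} (≡-mod d∣a-b) = ≡-mod (subst (+ d ∣_) (negate a b) (∣m⇒∣-m d∣a-b))
    where
    negate : ∀ a b → - (a - b) ≡ b - a
    negate = ℤ-Solver.solve-∀

  +-cong-mod : ∀ {a b c e} → a ≡ b mod d → c ≡ e mod d → a + c ≡ b + e mod d
  +-cong-mod {a} {b} {c} {e} (≡-mod d∣a-b) (≡-mod d∣c-e) =
    ≡-mod (subst (+ d ∣_) (regroup a b c e) (∣m∣n⇒∣m+n d∣a-b d∣c-e))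
    where
    regroup : ∀ a b c e → (a - b) + (c - e) ≡ (a + c) - (b + e)
    regroup = ℤ-Solver.solve-∀

  -‿cong-mod : ∀ {a b c e} → a ≡ b mod d → c ≡ e mod d → a - c ≡ b - e mod d
  -‿cong-mod {a} {b} {c} {e} (≡-mod d∣a-b) (≡-mod d∣c-e) =
    ≡-mod (subst (+ d ∣_) (regroup a b c e) (∣m∣n⇒∣m-n d∣a-b d∣c-e))
    where
    regroup : ∀ a b c e → (a - b) - (c - e) ≡ (a - c) - (b - e)
    regroup = ℤ-Solver.solve-∀

  *-congʳ-mod : ∀ {a b} c → a ≡ b mod d → a * c ≡ b * c mod d
  *-congʳ-mod {a} {b} c (≡-mod d∣a-b) = ≡-mod (subst (+ d ∣_) (distrib a b c) (∣m⇒∣m*n c d∣a-b))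
    where
    distrib : ∀ a b c → (a - b) * c ≡ a * c - b * c
    distrib = ℤ-Solver.solve-∀

  ∣⇒≡0-mod : ∀ {a} → + d ∣ a → a ≡ + 0 mod d
  ∣⇒≡0-mod {a} d∣a = ≡-mod (subst (+ d ∣_) (sym (ℤ.+-identityʳ a)) d∣a)

  ≡-mod-∣ : ∀ {a b} → a ≡ b mod d → + d ∣ a → + d ∣ b
  ≡-mod-∣ {a} {b} (≡-mod d∣a-b) d∣a = ∣m+n∣m⇒∣n (subst (+ d ∣_) (split a b) d∣a) d∣a-b
    where
    split : ∀ a b → a ≡ (a - b) + b
    split = ℤ-Solver.solve-∀

  module ≡-mod-Reasoning = Relation.Binary.Reasoning.Base.Single (λ a b → a ≡ b mod d) ≡-mod-refl ≡-mod-trans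

sumℤ-++ : ∀ xs ys → sumℤ (xs ++ ys) ≡ sumℤ xs + sumℤ ys
sumℤ-++ []       ys = sym (ℤ.+-identityˡ (sumℤ ys))
sumℤ-++ (x ∷ xs) ys = trans (cong (_+_ x) (sumℤ-++ xs ys)) (sym (ℤ.+-assoc x (sumℤ xs) (sumℤ ys)))

sumℤ-replicate : ∀ c z → sumℤ (List.replicate c z) ≡ + c * z
sumℤ-replicate zero    z = sym (ℤ.*-zeroˡ z)
sumℤ-replicate (suc c) z = begin
  z + sumℤ (List.replicate c z) ≡⟨ cong (_+_ z) (sumℤ-replicate c z) ⟩
  z + + c * z                   ≡⟨ distrib z (+ c) ⟩
  (+ 1 + + c) * z               ≡⟨ cong (_* z) (ℤ.pos-+ 1 c) ⟨
  + suc c * z                   ∎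
  where
  open ≡-Reasoning
  distrib : ∀ z c → z + c * z ≡ (+ 1 + c) * z
  distrib = ℤ-Solver.solve-∀

sumℤ-map-cong-mod : ∀ {A : Set} {d} {g h : A → ℤ} → (∀ a → g a ≡ h a mod d) →
  ∀ xs → sumℤ (List.map g xs) ≡ sumℤ (List.map h xs) mod d
sumℤ-map-cong-mod g≡h []       = ≡-mod-refl
sumℤ-map-cong-mod g≡h (x ∷ xs) = +-cong-mod (g≡h x) (sumℤ-map-cong-mod g≡h xs)

∈-replicate⁻ : ∀ {A : Set} c {x y : A} → y ∈ₗ List.replicate c x → y ≡ x × c ≢ 0
∈-replicate⁻ (suc c) (here y≡x)   = y≡x , λ ()
∈-replicate⁻ (suc c) (there y∈xs) = proj₁ (∈-replicate⁻ c y∈xs) , λ ()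

+[1+n]C[1+k]≡+nCk++nC[1+k] : ∀ n k → + (suc n C suc k) ≡ + (n C k) + + (n C suc k)
+[1+n]C[1+k]≡+nCk++nC[1+k] n k =
  trans (cong +_ (sym (nCk+nC[k+1]≡[n+1]C[k+1] n k))) (ℤ.pos-+ (n C k) (n C suc k))

[1+k]*[1+n]C[1+k]≡[1+n]*nCk : ∀ n k → suc k ℕ.* (suc n C suc k) ≡ suc n ℕ.* (n C k)
[1+k]*[1+n]C[1+k]≡[1+n]*nCk zero    zero    = refl
[1+k]*[1+n]C[1+k]≡[1+n]*nCk zero    (suc k) = ℕ.*-zeroʳ (suc (suc k))
[1+k]*[1+n]C[1+k]≡[1+n]*nCk (suc n) zero    =
  trans (ℕ.*-identityˡ _) (trans (nC1≡n (suc (suc n))) (sym (ℕ.*-identityʳ _)))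
[1+k]*[1+n]C[1+k]≡[1+n]*nCk (suc n) (suc k) = begin
  suc (suc k) ℕ.* (suc (suc n) C suc (suc k))
    ≡⟨ cong (suc (suc k) ℕ.*_) (sym (nCk+nC[k+1]≡[n+1]C[k+1] (suc n) (suc k))) ⟩
  suc (suc k) ℕ.* (a ℕ.+ b)
    ≡⟨ split-factor (suc k) a b ⟩
  a ℕ.+ suc k ℕ.* a ℕ.+ suc (suc k) ℕ.* b
    ≡⟨ cong₂ (λ u v → a ℕ.+ u ℕ.+ v) ([1+k]*[1+n]C[1+k]≡[1+n]*nCk n k) ([1+k]*[1+n]C[1+k]≡[1+n]*nCk n (suc k)) ⟩
  a ℕ.+ suc n ℕ.* (n C k) ℕ.+ suc n ℕ.* (n C suc k)
    ≡⟨ merge a (suc n) (n C k) (n C suc k) ⟩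
  a ℕ.+ suc n ℕ.* (n C k ℕ.+ n C suc k)
    ≡⟨ cong (λ c → a ℕ.+ suc n ℕ.* c) (nCk+nC[k+1]≡[n+1]C[k+1] n k) ⟩
  suc (suc n) ℕ.* a ∎
  where
  open ≡-Reasoning
  a b : ℕ
  a = suc n C suc k
  b = suc n C suc (suc k)
  split-factor : ∀ k a b → suc k ℕ.* (a ℕ.+ b) ≡ a ℕ.+ k ℕ.* a ℕ.+ suc k ℕ.* b
  split-factor = ℕ-Solver.solve-∀
  merge : ∀ a n c e → a ℕ.+ n ℕ.* c ℕ.+ n ℕ.* e ≡ a ℕ.+ n ℕ.* (c ℕ.+ e)
  merge = ℕ-Solver.solve-∀

prime^k∣m*n⇒∣m : ∀ {p} → Prime p → ∀ k {m n} → p ^ k ℕ∣.∣ m ℕ.* n → ¬ p ℕ∣.∣ n → p ^ k ℕ∣.∣ m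
prime^k∣m*n⇒∣m p-prime zero {m} _ _ = ℕ∣.1∣ m
prime^k∣m*n⇒∣m {p} p-prime (suc k) {m} {n} pᵏ⁺¹∣mn p∤n
  with euclidsLemma m n p-prime (ℕ∣.∣-trans (ℕ∣.m∣m*n (p ^ k)) pᵏ⁺¹∣mn)
... | inj₂ p∣n = contradiction p∣n p∤n
... | inj₁ (divides q refl) = subst (ℕ∣._∣ q ℕ.* p) (ℕ.*-comm (p ^ k) p) (ℕ∣.*-monoˡ-∣ p pᵏ∣q)
  where
  instance _ = prime⇒nonZero p-prime
  factor-p : ∀ q p n → q ℕ.* p ℕ.* n ≡ p ℕ.* (q ℕ.* n)
  factor-p = ℕ-Solver.solve-∀
  pᵏ∣q : p ^ k ℕ∣.∣ q
  pᵏ∣q = prime^k∣m*n⇒∣m p-prime k (ℕ∣.*-cancelˡ-∣ p (subst (p ℕ.* p ^ k ℕ∣.∣_) (factor-p q p n) pᵏ⁺¹∣mn)) p∤n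

module PrimePowerBinomials {p k m : ℕ} (p-prime : Prime p) (1+m≡pᵏ : suc m ≡ p ^ k) where

  p∣[1+m]C[1+j] : ∀ j → suc j < suc m → p ℕ∣.∣ suc m C suc j
  p∣[1+m]C[1+j] j 1+j<1+m with p ∣? suc m C suc j
  ... | yes p∣C = p∣C
  ... | no  p∤C = contradiction (ℕ∣.∣⇒≤ 1+m∣1+j) (ℕ.<⇒≱ 1+j<1+m)
    where
    pᵏ∣[1+j]*C : p ^ k ℕ∣.∣ suc j ℕ.* (suc m C suc j)
    pᵏ∣[1+j]*C = subst (ℕ∣._∣ _) 1+m≡pᵏ
      (divides (m C j) (trans ([1+k]*[1+n]C[1+k]≡[1+n]*nCk m j) (ℕ.*-comm (suc m) (m C j))))
    1+m∣1+j : suc m ℕ∣.∣ suc j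
    1+m∣1+j = subst (ℕ∣._∣ suc j) (sym 1+m≡pᵏ) (prime^k∣m*n⇒∣m p-prime k pᵏ∣[1+j]*C p∤C)

  open ≡-mod-Reasoning {p}

  [b+1+m]Cj≡bCj : ∀ b j → j < suc m → + ((b ℕ.+ suc m) C j) ≡ + (b C j) mod p
  [b+1+m]Cj≡bCj zero    zero    _ = ≡-mod-refl
  [b+1+m]Cj≡bCj zero    (suc j) j<1+m = ∣⇒≡0-mod (∣ᵤ⇒∣ (p∣[1+m]C[1+j] j j<1+m))
  [b+1+m]Cj≡bCj (suc b) zero    _ = ≡-mod-refl
  [b+1+m]Cj≡bCj (suc b) (suc j) 1+j<1+m = begin
    + ((suc b ℕ.+ suc m) C suc j)
      ≡⟨ +[1+n]C[1+k]≡+nCk++nC[1+k] (b ℕ.+ suc m) j ⟩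
    + ((b ℕ.+ suc m) C j) + + ((b ℕ.+ suc m) C suc j)
      ∼⟨ +-cong-mod ([b+1+m]Cj≡bCj b j (ℕ.<-trans (ℕ.n<1+n j) 1+j<1+m)) ([b+1+m]Cj≡bCj b (suc j) 1+j<1+m) ⟩
    + (b C j) + + (b C suc j)
      ≡⟨ +[1+n]C[1+k]≡+nCk++nC[1+k] b j ⟨
    + (suc b C suc j) ∎

  [r+q*[1+m]]Cj≡rCj : ∀ q r j → j < suc m → + ((r ℕ.+ q ℕ.* suc m) C j) ≡ + (r C j) mod p
  [r+q*[1+m]]Cj≡rCj zero    r j _ = begin
    + ((r ℕ.+ 0) C j) ≡⟨ cong (λ c → + (c C j)) (ℕ.+-identityʳ r) ⟩
    + (r C j)         ∎
  [r+q*[1+m]]Cj≡rCj (suc q) r j j<1+m = begin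
    + ((r ℕ.+ suc q ℕ.* suc m) C j)
      ≡⟨ cong (λ c → + (c C j)) (shift r q (suc m)) ⟩
    + ((r ℕ.+ q ℕ.* suc m ℕ.+ suc m) C j)
      ∼⟨ [b+1+m]Cj≡bCj (r ℕ.+ q ℕ.* suc m) j j<1+m ⟩
    + ((r ℕ.+ q ℕ.* suc m) C j)
      ∼⟨ [r+q*[1+m]]Cj≡rCj q r j j<1+m ⟩
    + (r C j) ∎
    where
    shift : ∀ r q M → r ℕ.+ (M ℕ.+ q ℕ.* M) ≡ r ℕ.+ q ℕ.* M ℕ.+ M
    shift = ℕ-Solver.solve-∀

  [1+m]∣1+c⇒cCm≡1 : ∀ c → suc m ℕ∣.∣ suc c → + (c C m) ≡ + 1 mod p
  [1+m]∣1+c⇒cCm≡1 c (divides (suc q) 1+c≡[1+q]*[1+m]) = begin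
    + (c C m)                   ≡⟨ cong (λ c → + (c C m)) (ℕ.suc-injective 1+c≡[1+q]*[1+m]) ⟩
    + ((m ℕ.+ q ℕ.* suc m) C m) ∼⟨ [r+q*[1+m]]Cj≡rCj q m m (ℕ.n<1+n m) ⟩
    + (m C m)                   ≡⟨ cong +_ (nCn≡1 m) ⟩
    + 1                         ∎

  [1+m]∤1+c⇒cCm≡0 : ∀ c → ¬ suc m ℕ∣.∣ suc c → + (c C m) ≡ + 0 mod p
  [1+m]∤1+c⇒cCm≡0 c [1+m]∤1+c = begin
    + (c C m)                   ≡⟨ cong (λ c → + (c C m)) c≡r+q*[1+m] ⟩
    + ((r ℕ.+ q ℕ.* suc m) C m) ∼⟨ [r+q*[1+m]]Cj≡rCj q r m (ℕ.n<1+n m) ⟩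
    + (r C m)                   ≡⟨ cong +_ (k>n⇒nCk≡0 r<m) ⟩
    + 0                         ∎
    where
    r q : ℕ
    r = c % suc m
    q = c / suc m
    c≡r+q*[1+m] : c ≡ r ℕ.+ q ℕ.* suc m
    c≡r+q*[1+m] = m≡m%n+[m/n]*n c (suc m)
    r≢m : r ≢ m
    r≢m r≡m = [1+m]∤1+c (divides (suc q) (cong suc (trans c≡r+q*[1+m] (cong (ℕ._+ q ℕ.* suc m) r≡m))))
    r<m : r < m
    r<m = ℕ.≤∧≢⇒< (ℕ.s≤s⁻¹ (m%n<n c (suc m))) r≢m

-- Δ n g = Σₓ (−1)^(n − |x|) g x, the top coefficient (of x₁⋯xₙ) of the multilinear
-- interpolant of g.
Δ : ∀ n → (Vec Bool n → ℤ) → ℤ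
Δ zero    g = g []
Δ (suc n) g = Δ n (λ x → g (true ∷ x)) - Δ n (λ x → g (false ∷ x))

Δ-cong : ∀ n {g h : Vec Bool n → ℤ} → (∀ x → g x ≡ h x) → Δ n g ≡ Δ n h
Δ-cong zero    g≗h = g≗h []
Δ-cong (suc n) g≗h = cong₂ _-_ (Δ-cong n (λ x → g≗h (true ∷ x))) (Δ-cong n (λ x → g≗h (false ∷ x)))

Δ-cong-mod : ∀ n {d} {g h : Vec Bool n → ℤ} → (∀ x → g x ≡ h x mod d) → Δ n g ≡ Δ n h mod d
Δ-cong-mod zero    g≡h = g≡h []
Δ-cong-mod (suc n) g≡h = -‿cong-mod (Δ-cong-mod n (λ x → g≡h (true ∷ x))) (Δ-cong-mod n (λ x → g≡h (false ∷ x)))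

Δ-+ : ∀ n (g h : Vec Bool n → ℤ) → Δ n (λ x → g x + h x) ≡ Δ n g + Δ n h
Δ-+ zero    g h = refl
Δ-+ (suc n) g h = trans (cong₂ _-_ (Δ-+ n g₁ h₁) (Δ-+ n g₀ h₀)) (regroup (Δ n g₁) (Δ n h₁) (Δ n g₀) (Δ n h₀))
  where
  g₁ g₀ h₁ h₀ : Vec Bool n → ℤ
  g₁ x = g (true ∷ x)
  g₀ x = g (false ∷ x)
  h₁ x = h (true ∷ x)
  h₀ x = h (false ∷ x)
  regroup : ∀ a b c e → (a + b) - (c + e) ≡ (a - c) + (b - e)
  regroup = ℤ-Solver.solve-∀

Δ-0 : ∀ n → Δ n (λ _ → + 0) ≡ + 0
Δ-0 zero = refl
Δ-0 (suc n) rewrite Δ-0 n = refl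

monoEval-⊥ : ∀ {n} (x : Vec Bool n) → monoEval ⊥ x ≡ + 1
monoEval-⊥ []      = refl
monoEval-⊥ (_ ∷ x) = monoEval-⊥ x

monoEval-∪ : ∀ {n} (G S : Subset n) x → monoEval G x * monoEval S x ≡ monoEval (G ∪ S) x
monoEval-∪ []          []          []          = refl
monoEval-∪ (true ∷ G)  (true ∷ S)  (true ∷ x)
  rewrite ℤ.*-identityˡ (monoEval G x) | ℤ.*-identityˡ (monoEval S x) | ℤ.*-identityˡ (monoEval (G ∪ S) x)
  = monoEval-∪ G S x
monoEval-∪ (true ∷ G)  (true ∷ S)  (false ∷ x)
  rewrite ℤ.*-zeroˡ (monoEval G x) | ℤ.*-zeroˡ (monoEval S x) | ℤ.*-zeroˡ (monoEval (G ∪ S) x)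
  = refl
monoEval-∪ (true ∷ G)  (false ∷ S) (b ∷ x)     =
  trans (ℤ.*-assoc ⟦ b ⟧ _ _) (cong (⟦ b ⟧ *_) (monoEval-∪ G S x))
monoEval-∪ (false ∷ G) (true ∷ S)  (b ∷ x)     =
  trans (swap (monoEval G x) ⟦ b ⟧ (monoEval S x)) (cong (⟦ b ⟧ *_) (monoEval-∪ G S x))
  where
  swap : ∀ a b c → a * (b * c) ≡ b * (a * c)
  swap = ℤ-Solver.solve-∀
monoEval-∪ (false ∷ G) (false ∷ S) (_ ∷ x)     = monoEval-∪ G S x

IsBit : ℤ → Set
IsBit z = z ≡ + 0 ⊎ z ≡ + 1

monoEval-isBit : ∀ {n} (S : Subset n) x → IsBit (monoEval S x)
monoEval-isBit []          []          = inj₂ refl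
monoEval-isBit (true ∷ S)  (true ∷ x)  rewrite ℤ.*-identityˡ (monoEval S x) = monoEval-isBit S x
monoEval-isBit (true ∷ S)  (false ∷ x) = inj₁ (ℤ.*-zeroˡ (monoEval S x))
monoEval-isBit (false ∷ S) (_ ∷ x)     = monoEval-isBit S x

monoEval-⊤-𝟏 : ∀ n → monoEval ⊤ (replicate n true) ≡ + 1
monoEval-⊤-𝟏 zero    = refl
monoEval-⊤-𝟏 (suc n) = trans (ℤ.*-identityˡ _) (monoEval-⊤-𝟏 n)

monoEval-⊤-≢𝟏 : ∀ {n} (x : Vec Bool n) → x ≢ replicate n true → monoEval ⊤ x ≡ + 0
monoEval-⊤-≢𝟏 []          x≢𝟏 = contradiction refl x≢𝟏
monoEval-⊤-≢𝟏 (true ∷ x)  x≢𝟏 = trans (ℤ.*-identityˡ _) (monoEval-⊤-≢𝟏 x (x≢𝟏 ∘ cong (true ∷_)))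
monoEval-⊤-≢𝟏 (false ∷ x) _   = ℤ.*-zeroˡ (monoEval ⊤ x)

Δ-monoEval-inside : ∀ n (G : Subset n) → Δ (suc n) (monoEval (true ∷ G)) ≡ Δ n (monoEval G)
Δ-monoEval-inside n G = begin
  Δ n (λ x → + 1 * monoEval G x) - Δ n (λ x → + 0 * monoEval G x)
    ≡⟨ cong₂ _-_ (Δ-cong n (λ x → ℤ.*-identityˡ (monoEval G x))) (Δ-cong n (λ x → ℤ.*-zeroˡ (monoEval G x))) ⟩
  Δ n (monoEval G) - Δ n (λ _ → + 0)
    ≡⟨ cong (_-_ (Δ n (monoEval G))) (Δ-0 n) ⟩
  Δ n (monoEval G) - + 0
    ≡⟨ ℤ.+-identityʳ (Δ n (monoEval G)) ⟩
  Δ n (monoEval G) ∎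
  where open ≡-Reasoning

Δ-monoEval-⊤ : ∀ n → Δ n (monoEval (⊤ {n})) ≡ + 1
Δ-monoEval-⊤ zero    = refl
Δ-monoEval-⊤ (suc n) = trans (Δ-monoEval-inside n ⊤) (Δ-monoEval-⊤ n)

Δ-monoEval≢0⇒⊤ : ∀ n (G : Subset n) → Δ n (monoEval G) ≢ + 0 → ∀ i → i ∈ G
Δ-monoEval≢0⇒⊤ (suc n) (true ∷ G)  Δ≢0 fzero    = Vec.here
Δ-monoEval≢0⇒⊤ (suc n) (true ∷ G)  Δ≢0 (fsuc i) =
  Vec.there (Δ-monoEval≢0⇒⊤ n G (Δ≢0 ∘ trans (Δ-monoEval-inside n G)) i)
Δ-monoEval≢0⇒⊤ (suc n) (false ∷ G) Δ≢0 _        = contradiction (ℤ.+-inverseʳ (Δ n (monoEval G))) Δ≢0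

esym : ℕ → List ℤ → ℤ
esym zero    _        = + 1
esym (suc r) []       = + 0
esym (suc r) (z ∷ zs) = esym (suc r) zs + z * esym r zs

esym-bits : ∀ zs → All IsBit zs → ∃ λ c → sumℤ zs ≡ + c × ∀ r → esym r zs ≡ + (c C r)
esym-bits []       []                = 0 , refl , λ { zero → refl ; (suc r) → refl }
esym-bits (_ ∷ zs) (inj₁ refl ∷ bits) with esym-bits zs bits
... | c , Σzs≡c , esym≡C = c , trans (ℤ.+-identityˡ _) Σzs≡c , esym≡C′
  where
  esym≡C′ : ∀ r → esym r (+ 0 ∷ zs) ≡ + (c C r)
  esym≡C′ zero    = refl
  esym≡C′ (suc r) = trans (cong₂ _+_ (esym≡C (suc r)) (ℤ.*-zeroˡ (esym r zs))) (ℤ.+-identityʳ _)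
esym-bits (_ ∷ zs) (inj₂ refl ∷ bits) with esym-bits zs bits
... | c , Σzs≡c , esym≡C = suc c , trans (cong (_+_ (+ 1)) Σzs≡c) (sym (ℤ.pos-+ 1 c)) , esym≡C′
  where
  esym≡C′ : ∀ r → esym r (+ 1 ∷ zs) ≡ + (suc c C r)
  esym≡C′ zero    = refl
  esym≡C′ (suc r) = begin
    esym (suc r) zs + + 1 * esym r zs ≡⟨ cong₂ _+_ (esym≡C (suc r)) (trans (ℤ.*-identityˡ _) (esym≡C r)) ⟩
    + (c C suc r) + + (c C r)         ≡⟨ ℤ.+-comm (+ (c C suc r)) (+ (c C r)) ⟩
    + (c C r) + + (c C suc r)         ≡⟨ +[1+n]C[1+k]≡+nCk++nC[1+k] c r ⟨
    + (suc c C suc r)                 ∎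
    where open ≡-Reasoning

monoEvals : ∀ {n} → List (Subset n) → Vec Bool n → List ℤ
monoEvals Ss x = List.map (λ S → monoEval S x) Ss

monoEvals-isBit : ∀ {n} (Ss : List (Subset n)) x → All IsBit (monoEvals Ss x)
monoEvals-isBit []       x = []
monoEvals-isBit (S ∷ Ss) x = monoEval-isBit S x ∷ monoEvals-isBit Ss x

CoversAll : ∀ {n} → Subset n → List (Subset n) → Set
CoversAll G Ts = ∀ i → i ∈ G ⊎ Any (i ∈_) Ts

Δ-esym-∷ : ∀ n r (G S : Subset n) Ss →
  Δ n (λ x → monoEval G x * esym (suc r) (monoEvals (S ∷ Ss) x))
  ≡ Δ n (λ x → monoEval G x * esym (suc r) (monoEvals Ss x)) + Δ n (λ x → monoEval (G ∪ S) x * esym r (monoEvals Ss x))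
Δ-esym-∷ n r G S Ss = trans (Δ-cong n expand) (Δ-+ n _ _)
  where
  expand : ∀ x → monoEval G x * (esym (suc r) (monoEvals Ss x) + monoEval S x * esym r (monoEvals Ss x))
               ≡ monoEval G x * esym (suc r) (monoEvals Ss x) + monoEval (G ∪ S) x * esym r (monoEvals Ss x)
  expand x = begin
    g * (e′ + s * e)                ≡⟨ ℤ.*-distribˡ-+ g e′ (s * e) ⟩
    g * e′ + g * (s * e)            ≡⟨ cong (_+_ (g * e′)) (sym (ℤ.*-assoc g s e)) ⟩
    g * e′ + g * s * e              ≡⟨ cong (λ t → g * e′ + t * e) (monoEval-∪ G S x) ⟩
    g * e′ + monoEval (G ∪ S) x * e ∎
    where
    open ≡-Reasoning
    g s e′ e : ℤ
    g = monoEval G x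
    s = monoEval S x
    e′ = esym (suc r) (monoEvals Ss x)
    e = esym r (monoEvals Ss x)

Δ[x_G*esym]≢0⇒cover : ∀ {n} (Ls : List (Subset n)) r (G : Subset n) →
  Δ n (λ x → monoEval G x * esym r (monoEvals Ls x)) ≢ + 0 →
  ∃ λ Ts → All (_∈ₗ Ls) Ts × length Ts ℕ.≤ r × CoversAll G Ts
Δ[x_G*esym]≢0⇒cover {n} Ls zero G Δ≢0 =
  [] , [] , ℕ.z≤n , λ i → inj₁ (Δ-monoEval≢0⇒⊤ n G (Δ≢0 ∘ trans (Δ-cong n (λ x → ℤ.*-identityʳ _))) i)
Δ[x_G*esym]≢0⇒cover {n} [] (suc r) G Δ≢0 =
  contradiction (trans (Δ-cong n (λ x → ℤ.*-zeroʳ (monoEval G x))) (Δ-0 n)) Δ≢0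
Δ[x_G*esym]≢0⇒cover {n} (S ∷ Ls) (suc r) G Δ≢0
  with Δ n (λ x → monoEval G x * esym (suc r) (monoEvals Ls x)) ℤ.≟ + 0
... | no  Δ′≢0 with Δ[x_G*esym]≢0⇒cover Ls (suc r) G Δ′≢0
...   | Ts , Ts⊆Ls , |Ts|≤1+r , covers = Ts , All.map there Ts⊆Ls , |Ts|≤1+r , covers
Δ[x_G*esym]≢0⇒cover {n} (S ∷ Ls) (suc r) G Δ≢0
    | yes Δ′≡0 with Δ[x_G*esym]≢0⇒cover Ls r (G ∪ S) Δ″≢0
  where
  Δ″≢0 : Δ n (λ x → monoEval (G ∪ S) x * esym r (monoEvals Ls x)) ≢ + 0
  Δ″≢0 Δ″≡0 = Δ≢0 (trans (Δ-esym-∷ n r G S Ls) (cong₂ _+_ Δ′≡0 Δ″≡0))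
...   | Ts , Ts⊆Ls , |Ts|≤r , covers = S ∷ Ts , here refl ∷ All.map there Ts⊆Ls , ℕ.s≤s |Ts|≤r , covers′
  where
  covers′ : CoversAll G (S ∷ Ts)
  covers′ i with covers i
  ... | inj₂ i∈Ts = inj₂ (there i∈Ts)
  ... | inj₁ i∈G∪S with x∈p∪q⁻ G S i∈G∪S
  ...   | inj₁ i∈G = inj₁ i∈G
  ...   | inj₂ i∈S = inj₂ (here i∈S)

module NANDCover {p k m : ℕ} (p-prime : Prime p) (1+m≡pᵏ : suc m ≡ p ^ k) {n} (f : MultilinearPoly n) where

  open PrimePowerBinomials {k = k} p-prime 1+m≡pᵏ

  residue : Subset n → ℕ
  residue S = f S %ℕ suc m

  copies : Subset n → List (Subset n)
  copies S = List.replicate (residue S) S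

  monomials : List (Subset n)
  monomials = List.replicate m ⊥ ++ List.concatMap copies (allSubsets n)

  residueSum : Vec Bool n → ℤ
  residueSum x = sumℤ (List.map (λ S → + residue S * monoEval S x) (allSubsets n))

  residue≡coefficient : ∀ S → + residue S ≡ f S mod suc m
  residue≡coefficient S = ≡-mod-sym (≡-mod (ℤ∣.divides (f S /ℕ suc m) (begin
    f S - + residue S                                    ≡⟨ cong (_- + residue S) (a≡a%ℕn+[a/ℕn]*n (f S) (suc m)) ⟩
    (+ residue S + f S /ℕ suc m * + suc m) - + residue S ≡⟨ cancel (+ residue S) _ ⟩
    f S /ℕ suc m * + suc m                               ∎)))
    where
    open ≡-Reasoning
    cancel : ∀ r t → (r + t) - r ≡ t
    cancel = ℤ-Solver.solve-∀

  sum-monoEvals-copies : ∀ Ss x →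
    sumℤ (monoEvals (List.concatMap copies Ss) x) ≡ sumℤ (List.map (λ S → + residue S * monoEval S x) Ss)
  sum-monoEvals-copies []       x = refl
  sum-monoEvals-copies (S ∷ Ss) x = begin
    sumℤ (monoEvals (copies S ++ List.concatMap copies Ss) x)
      ≡⟨ cong sumℤ (map-++ (λ T → monoEval T x) (copies S) _) ⟩
    sumℤ (monoEvals (copies S) x ++ monoEvals (List.concatMap copies Ss) x)
      ≡⟨ sumℤ-++ (monoEvals (copies S) x) _ ⟩
    sumℤ (monoEvals (copies S) x) + sumℤ (monoEvals (List.concatMap copies Ss) x)
      ≡⟨ cong₂ _+_ (trans (cong sumℤ (map-replicate (λ T → monoEval T x) (residue S) S)) (sumℤ-replicate (residue S) _))
                   (sum-monoEvals-copies Ss x) ⟩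
    + residue S * monoEval S x + sumℤ (List.map (λ S → + residue S * monoEval S x) Ss) ∎
    where open ≡-Reasoning

  sum-monoEvals : ∀ x → sumℤ (monoEvals monomials x) ≡ + m + residueSum x
  sum-monoEvals x = begin
    sumℤ (monoEvals monomials x)
      ≡⟨ cong sumℤ (map-++ (λ T → monoEval T x) (List.replicate m ⊥) _) ⟩
    sumℤ (monoEvals (List.replicate m ⊥) x ++ monoEvals (List.concatMap copies (allSubsets n)) x)
      ≡⟨ sumℤ-++ (monoEvals (List.replicate m ⊥) x) _ ⟩
    sumℤ (monoEvals (List.replicate m ⊥) x) + sumℤ (monoEvals (List.concatMap copies (allSubsets n)) x)
      ≡⟨ cong₂ _+_ ones (sum-monoEvals-copies (allSubsets n) x) ⟩
    + m + residueSum x ∎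
    where
    open ≡-Reasoning
    ones : sumℤ (monoEvals (List.replicate m ⊥) x) ≡ + m
    ones = begin
      sumℤ (monoEvals (List.replicate m ⊥) x) ≡⟨ cong sumℤ (map-replicate (λ T → monoEval T x) m ⊥) ⟩
      sumℤ (List.replicate m (monoEval ⊥ x))  ≡⟨ sumℤ-replicate m _ ⟩
      + m * monoEval ⊥ x                      ≡⟨ cong (_*_ (+ m)) (monoEval-⊥ x) ⟩
      + m * + 1                               ≡⟨ ℤ.*-identityʳ (+ m) ⟩
      + m                                     ∎

  1+count≡eval : ∀ x {c} → sumℤ (monoEvals monomials x) ≡ + c → + suc c ≡ eval f x mod suc m
  1+count≡eval x {c} count≡c = begin
    + suc c                    ≡⟨ ℤ.pos-+ 1 c ⟩
    + 1 + + c                  ≡⟨ cong (_+_ (+ 1)) (trans (sym count≡c) (sum-monoEvals x)) ⟩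
    + 1 + (+ m + residueSum x) ≡⟨ ℤ.+-assoc (+ 1) (+ m) (residueSum x) ⟨
    + suc m + residueSum x     ∼⟨ +-cong-mod (∣⇒≡0-mod ∣-refl) (≡-mod-refl {a = residueSum x}) ⟩
    + 0 + residueSum x         ≡⟨ ℤ.+-identityˡ (residueSum x) ⟩
    residueSum x               ∼⟨ sumℤ-map-cong-mod (λ S → *-congʳ-mod (monoEval S x) (residue≡coefficient S)) (allSubsets n) ⟩
    eval f x                   ∎
    where open ≡-mod-Reasoning

  module _ (f-rep : RepresentsNAND (suc m) f) where

    esym-monomials≡x_⊤ : ∀ x → esym m (monoEvals monomials x) ≡ monoEval ⊤ x mod p
    esym-monomials≡x_⊤ x with esym-bits (monoEvals monomials x) (monoEvals-isBit monomials x)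
    ... | c , count≡c , esym≡C with ≡-dec Bool._≟_ x (replicate n true)
    ...   | yes refl = begin
      esym m (monoEvals monomials x) ≡⟨ esym≡C m ⟩
      + (c C m)                      ∼⟨ [1+m]∣1+c⇒cCm≡1 c [1+m]∣1+c ⟩
      + 1                            ≡⟨ monoEval-⊤-𝟏 n ⟨
      monoEval ⊤ x                   ∎
      where
      open ≡-mod-Reasoning
      [1+m]∣1+c : suc m ℕ∣.∣ suc c
      [1+m]∣1+c = ∣⇒∣ᵤ (≡-mod-∣ (≡-mod-sym (1+count≡eval x count≡c)) (∣ᵤ⇒∣ (proj₁ f-rep)))
    ...   | no x≢𝟏 = begin
      esym m (monoEvals monomials x) ≡⟨ esym≡C m ⟩
      + (c C m)                      ∼⟨ [1+m]∤1+c⇒cCm≡0 c [1+m]∤1+c ⟩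
      + 0                            ≡⟨ monoEval-⊤-≢𝟏 x x≢𝟏 ⟨
      monoEval ⊤ x                   ∎
      where
      open ≡-mod-Reasoning
      [1+m]∤1+c : ¬ suc m ℕ∣.∣ suc c
      [1+m]∤1+c [1+m]∣1+c = proj₂ f-rep x x≢𝟏 (∣⇒∣ᵤ (≡-mod-∣ (1+count≡eval x count≡c) (∣ᵤ⇒∣ [1+m]∣1+c)))

    Δ-esym-monomials≢0 : Δ n (λ x → monoEval ⊥ x * esym m (monoEvals monomials x)) ≢ + 0
    Δ-esym-monomials≢0 Δ≡0 = ¬prime[1] (subst Prime (ℕ∣.∣1⇒≡1 p∣1) p-prime)
      where
      Δ≡1 : Δ n (λ x → monoEval ⊥ x * esym m (monoEvals monomials x)) ≡ + 1 mod p
      Δ≡1 = begin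
        Δ n (λ x → monoEval ⊥ x * esym m (monoEvals monomials x))
          ≡⟨ Δ-cong n (λ x → trans (cong (_* esym m (monoEvals monomials x)) (monoEval-⊥ x)) (ℤ.*-identityˡ _)) ⟩
        Δ n (λ x → esym m (monoEvals monomials x)) ∼⟨ Δ-cong-mod n esym-monomials≡x_⊤ ⟩
        Δ n (monoEval ⊤)                           ≡⟨ Δ-monoEval-⊤ n ⟩
        + 1 ∎
        where open ≡-mod-Reasoning
      p∣1 : p ℕ∣.∣ 1
      p∣1 = ∣⇒∣ᵤ (≡-mod-∣ Δ≡1 (subst (+ p ∣_) (sym Δ≡0) (∣ᵤ⇒∣ (p ℕ∣.∣0))))

  coefficient≢0 : ∀ {T i} → T ∈ₗ monomials → i ∈ T → f T ≢ + 0
  coefficient≢0 T∈ i∈T with ∈-++⁻ (List.replicate m ⊥) T∈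
  ... | inj₁ T∈⊥s = contradiction (subst (_ ∈_) (proj₁ (∈-replicate⁻ m T∈⊥s)) i∈T) ∉⊥
  ... | inj₂ T∈copies with find (∈-concatMap⁻ copies {xs = allSubsets n} T∈copies)
  ...   | S , _ , T∈copies-S with ∈-replicate⁻ (residue S) T∈copies-S
  ...     | refl , residue≢0 = λ fS≡0 → residue≢0 (cong (_%ℕ suc m) fS≡0)

  cover : RepresentsNAND (suc m) f → CovLe f m
  cover f-rep with Δ[x_G*esym]≢0⇒cover monomials m ⊥ (Δ-esym-monomials≢0 f-rep)
  ... | Ts , Ts⊆monomials , |Ts|≤m , covers =
    filter nonzero? Ts , (all-filter nonzero? Ts , covers′) , ℕ.≤-trans (length-filter nonzero? Ts) |Ts|≤m
    where
    nonzero? : ∀ T → Dec (f T ≢ + 0)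
    nonzero? T = ¬? (f T ℤ.≟ + 0)
    covers′ : ∀ i → Appears f i → Any (i ∈_) (filter nonzero? Ts)
    covers′ i _ with covers i
    ... | inj₁ i∈⊥ = contradiction i∈⊥ ∉⊥
    ... | inj₂ i∈Ts with find i∈Ts
    ...   | T , T∈Ts , i∈T = lose (∈-filter⁺ nonzero? T∈Ts (coefficient≢0 (All.lookup Ts⊆monomials T∈Ts) i∈T)) i∈T

proposition3p16 : (M : ℕ) → IsPrimePower M → (n : ℕ) → (f : MultilinearPoly n) →
    RepresentsNAND M f → CovLe f (M ∸ 1)
proposition3p16 zero    (p , k , p-prime , _ , 0≡pᵏ) n f _ =
  contradiction (sym 0≡pᵏ) (ℕ.≢-nonZero⁻¹ (p ^ k) {{ℕ.m^n≢0 p k {{prime⇒nonZero p-prime}}}})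
proposition3p16 (suc m) (p , k , p-prime , _ , 1+m≡pᵏ) n f f-rep = NANDCover.cover {k = k} p-prime 1+m≡pᵏ f f-rep
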